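{- Let $R$ be a relation and $\Sigma_{\mathrm{FD}}$ a set of FDs on $R$ closed under implication, with $\Sigma_{\mathrm{UFD}}$ its unary FDs. For any $R^p\in\mathrm{Pos}(R)$ and any UFD $R^q\to R^r$ of $\Sigma_{\mathrm{FD}}$, if $R^q\in\mathrm{NDng}(R^p)$ then $R^r\in\mathrm{NDng}(R^p)$.
   Context: $\mathrm{Pos}(R)=\{R^1,\dots,R^{|R|}\}$. An FD $R^L\to R^r$ states that two $R$-facts agreeing on $L$ agree on $R^r$; unary (UFD) if $|L|=1$. The dangerous positions of $R^p$ are $\mathrm{Dng}(R^p)=\{R^r\in\mathrm{Pos}(R)\setminus\{R^p\}: R^r\to R^p\in\Sigma_{\mathrm{UFD}}\}$, and the non-dangerous positions are $\mathrm{NDng}(R^p)=\mathrm{Pos}(R)\setminus(\{R^p\}\cup\mathrm{Dng}(R^p))$. -}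

module Defs where

open import Data.Nat using (ℕ)
open import Data.Fin using (Fin)
open import Data.Fin.Subset using (Subset; _∈_; ⁅_⁆)
open import Data.Product using (_×_)
open import Relation.Binary.PropositionalEquality using (_≡_)
open import Relation.Nullary using (¬_)
open import Level using (Level; suc; _⊔_)

-- A relation symbol R of arity n; its positions R^1..R^n are Fin n.
-- A fact of R is a tuple of constants (constants drawn from ℕ).
Fact : ℕ → Set
Fact n = Fin n → ℕ

Instance : ℕ → Set₁
Instance n = Fact n → Set

record FD (n : ℕ) : Set where
  constructor _⇒_
  field
    lhs : Subset n
    rhs : Fin n

open FD public

Satisfies : ∀ {n} → Instance n → FD n → Set
Satisfies D (L ⇒ r) =
  ∀ f g → D f → D g → (∀ i → i ∈ L → f i ≡ g i) → f r ≡ g r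

FDSet : ℕ → Set₁
FDSet n = FD n → Set

Implies : ∀ {n} → FDSet n → FD n → Set₁
Implies Σ φ = ∀ (D : Instance _) → (∀ ψ → Σ ψ → Satisfies D ψ) → Satisfies D φ

ClosedUnderImplication : ∀ {n} → FDSet n → Set₁
ClosedUnderImplication Σ = ∀ φ → Implies Σ φ → Σ φ

UFDin : ∀ {n} → FDSet n → Fin n → Fin n → Set
UFDin Σ q r = Σ (⁅ q ⁆ ⇒ r)

Dng : ∀ {n} → FDSet n → Fin n → Fin n → Set
Dng Σ p r = ¬ (r ≡ p) × UFDin Σ r p

NDng : ∀ {n} → FDSet n → Fin n → Fin n → Set
NDng Σ p r = ¬ (r ≡ p) × ¬ Dng Σ p r

module Submission where

-- Unary FDs compose: from R^q → R^r and R^r → R^p every instance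
-- satisfying both also satisfies R^q → R^p, so a set of FDs closed under
-- implication contains R^q → R^p.  Now let R^q ∈ NDng(R^p) and R^q → R^r ∈ Σ.
--   * R^r ≠ R^p: otherwise R^q → R^p ∈ Σ with R^q ≠ R^p, i.e. R^q ∈ Dng(R^p).
--   * R^r ∉ Dng(R^p): otherwise R^r → R^p ∈ Σ, and by transitivity
--     R^q → R^p ∈ Σ, again making R^q dangerous.

open import Defs
open import Data.Nat using (ℕ)
open import Data.Fin using (Fin)
open import Data.Fin.Subset using (⁅_⁆; _∈_)
open import Data.Fin.Subset.Properties using (x∈⁅y⁆⇒x≡y)
open import Data.Empty using (⊥)
open import Data.Product using (_,_)
open import Relation.Binary.PropositionalEquality using (_≡_; refl; subst)

-- Two facts agreeing at position r agree on every position of ⁅ r ⁆; this is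
-- what is needed to apply a satisfied unary FD with left-hand side r.
agree-⁅⁆ : ∀ {n} (f g : Fact n) (r : Fin n) →
  f r ≡ g r → ∀ i → i ∈ ⁅ r ⁆ → f i ≡ g i
agree-⁅⁆ f g r fr≡gr i i∈⁅r⁆ with x∈⁅y⁆⇒x≡y r i∈⁅r⁆
... | refl = fr≡gr

satisfies-trans : ∀ {n} (D : Instance n) (q r p : Fin n) →
  Satisfies D (⁅ q ⁆ ⇒ r) → Satisfies D (⁅ r ⁆ ⇒ p) → Satisfies D (⁅ q ⁆ ⇒ p)
satisfies-trans D q r p sat-qr sat-rp f g Df Dg agree-q =
  sat-rp f g Df Dg (agree-⁅⁆ f g r (sat-qr f g Df Dg agree-q))

ufd-trans : ∀ {n} (Σ : FDSet n) → ClosedUnderImplication Σ →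
  (q r p : Fin n) → UFDin Σ q r → UFDin Σ r p → UFDin Σ q p
ufd-trans Σ closed q r p qr rp = closed (⁅ q ⁆ ⇒ p) implied
  where
  implied : Implies Σ (⁅ q ⁆ ⇒ p)
  implied D satΣ = satisfies-trans D q r p (satΣ _ qr) (satΣ _ rp)

mainTheorem11 : (n : ℕ) (Σ : FDSet n) → ClosedUnderImplication Σ →
    (p q r : Fin n) → UFDin Σ q r → NDng Σ p q → NDng Σ p r
mainTheorem11 n Σ closed p q r qr (q≢p , q-not-dangerous) = r≢p , r-not-dangerous
  where
  q-not-into-p : UFDin Σ q p → ⊥
  q-not-into-p qp = q-not-dangerous (q≢p , qp)

  r≢p : r ≡ p → ⊥
  r≢p r≡p = q-not-into-p (subst (UFDin Σ q) r≡p qr)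

  r-not-dangerous : Dng Σ p r → ⊥
  r-not-dangerous (_ , rp) = q-not-into-p (ufd-trans Σ closed q r p qr rp)
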